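{- Let $n\ge1$ and $m$ be integers. (i) If $0\le m\le n$ and $\tfrac{h_j}{k_j}<\tfrac{h_{j+1}}{k_{j+1}}$ are two successive fractions of $\mathcal F(\mathbb B(n),m;\rho)$ (in lowest terms), then $k_jh_{j+1}-h_jk_{j+1}=1$. (ii) If $0<m<n$ and $\tfrac{h_j}{k_j}<\tfrac{h_{j+1}}{k_{j+1}}<\tfrac{h_{j+2}}{k_{j+2}}$ are three successive fractions of $\mathcal F(\mathbb B(n),m;\rho)$, then $$\frac{h_{j+1}}{k_{j+1}}=\frac{(h_j+h_{j+2})/\gcd(h_j+h_{j+2},k_j+k_{j+2})}{(k_j+k_{j+2})/\gcd(h_j+h_{j+2},k_j+k_{j+2})},$$ i.e. $\tfrac{h_{j+1}}{k_{j+1}}$ is the reduced form of $\tfrac{h_j+h_{j+2}}{k_j+k_{j+2}}$.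
   Context: $\mathcal F_n$ is the Farey sequence of order $n$: the ascending sequence of all irreducible fractions in $[0,1]$ with denominator at most $n$. For $0\le m\le n$, $\mathcal F(\mathbb B(n),m;\rho)$ is the ascending sequence of irreducible fractions $\{\tfrac01,\tfrac11\}\cup\{\tfrac hk\in\mathcal F_n:\ h\le m,\ k-h\le n-m\}$ (equivalently, $\tfrac01,\tfrac11$ together with the reduced forms of $\rho(a\wedge b)/\rho(b)$ for $b\neq\hat0$ in the Boolean lattice $\mathbb B(n)$ of rank $n$, where $a$ is a fixed element of rank $m$ and $\rho$ is rank). -}

module Defs where

open import Data.Nat using (ℕ; zero; suc; _+_; _*_; _∸_; _≤_; _<_)
open import Data.Nat.DivMod using (_/_)
open import Data.Nat.GCD using (gcd)
open import Data.Nat.Coprimality using (Coprime)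
open import Data.Product using (_×_; _,_)
open import Data.Sum using (_⊎_)
open import Data.Empty using (⊥)
open import Relation.Binary.PropositionalEquality using (_≡_)

-- InF n m h k : h/k (in lowest terms) is a member of F(B(n), m; ρ), i.e.
--   h/k is an irreducible fraction in F_n (1 ≤ k ≤ n, h ≤ k, gcd h k = 1)
--   and either h/k ∈ {0/1, 1/1} or (h ≤ m and k - h ≤ n - m).
InF : ℕ → ℕ → ℕ → ℕ → Set
InF n m h k =
  (1 ≤ k) × (k ≤ n) × (h ≤ k) × Coprime h k ×
  (((h ≡ 0) × (k ≡ 1)) ⊎ ((h ≡ 1) × (k ≡ 1)) ⊎ ((h ≤ m) × (k ∸ h ≤ n ∸ m)))

_⟨_<_⟩_ : ℕ → ℕ → ℕ → ℕ → Set
h ⟨ k < h' ⟩ k' = h * k' < h' * k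

Successive : ℕ → ℕ → ℕ → ℕ → ℕ → ℕ → Set
Successive n m h k h' k' =
  InF n m h k × InF n m h' k' × (h ⟨ k < h' ⟩ k') ×
  ((a b : ℕ) → InF n m a b → h ⟨ k < a ⟩ b → a ⟨ b < h' ⟩ k' → ⊥)

-- reduced form of a/b: (a / gcd a b , b / gcd a b); when gcd a b = 0
-- (only if a = b = 0) the pair is returned unchanged.
reduce : ℕ → ℕ → ℕ × ℕ
reduce a b with gcd a b
... | zero  = a , b
... | suc g = a / suc g , b / suc g

-- Write a fraction h/k as the lattice point (h, k − h). Then F(B(n),m;ρ) consists of (0,1),
-- (1,0) and the primitive points of the box [0,m] × [0,n−m], ordered by slope, and k h′ − h k′
-- becomes the determinant b c − a d of the points P = (a,b), Q = (c,d). Bézout, reduced modulo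
-- P, gives a point w = (x,z) of the box with b x − a z = 1; adding P to w as long as the sum
-- stays in the box, we may assume that P + w leaves it. Since w ∈ F lies above P, the successor
-- Q of P does not lie above w, so Cramer's rule writes Q = αP + Dw with α ≥ 0 and
-- D = b c − a d ≥ 1. If α ≥ 1 then P + w ≤ Q would lie in the box; hence α = 0, and D = 1
-- because Q is primitive. For (ii), k₁h₂ − h₁k₂ = 1 = k₂h₃ − h₂k₃ gives
-- (h₁ + h₃)k₂ = h₂(k₁ + k₃), and h₂/k₂ is in lowest terms.

{-# OPTIONS --safe #-}
module Submission where

open import Defs
open import Data.Nat
  using (ℕ; zero; suc; _+_; _*_; _∸_; _≤_; _<_; z≤n; s≤s; _≤?_; NonZero; >-nonZero; >-nonZero⁻¹)
open import Data.Nat.Properties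
open import Data.Nat.Divisibility
  using (_∣_; divides; ∣-trans; n∣m*n; m∣m*n; ∣m∣n⇒∣m+n; ∣m+n∣m⇒∣n; ∣1⇒≡1)
open import Data.Nat.Coprimality as Coprime
  using (Coprime; coprime-Bézout; coprime-divisor; coprime-+; coprime⇒gcd≡1; 0-coprimeTo-m⇒m≡1; 1-coprimeTo)
open import Data.Nat.GCD using (gcd; c*gcd[m,n]≡gcd[cm,cn]; module Bézout)
open import Data.Nat.DivMod using (_/_; _%_; m*n/n≡m; m≡m%n+[m/n]*n; m%n<n)
open import Data.Nat.Tactic.RingSolver using (solve)
open import Data.List using (_∷_; [])
open import Data.Product as Product using (_×_; _,_; ∃; ∃₂)
open import Data.Sum using (inj₁; inj₂)
open import Data.Empty using (⊥-elim)
open import Function using (_∘_)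
open import Function.Bundles using (_⇔_; mk⇔; module Equivalence)
open import Relation.Nullary using (¬_; yes; no; Dec)
open import Relation.Nullary.Decidable using (_×-dec_)
open import Relation.Unary using (Decidable)
open import Relation.Binary.PropositionalEquality

P0∧¬PN⇒∃[t]Pt∧¬P[1+t] : {P : ℕ → Set} → Decidable P → P 0 → ∀ N → ¬ P N →
                         ∃ λ t → P t × ¬ P (suc t)
P0∧¬PN⇒∃[t]Pt∧¬P[1+t] P? P0 zero    ¬P0  = ⊥-elim (¬P0 P0)
P0∧¬PN⇒∃[t]Pt∧¬P[1+t] P? P0 (suc N) ¬P1+N with P? N
... | yes PN = N , PN , ¬P1+N
... | no ¬PN = P0∧¬PN⇒∃[t]Pt∧¬P[1+t] P? P0 N ¬PN

unimodular⇒1≤x : ∀ {a b x z} → b * x ≡ a * z + 1 → 1 ≤ x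
unimodular⇒1≤x {a} {b} {zero} {z} E =
  ⊥-elim (0≢1+n (trans (sym (*-zeroʳ b)) (trans E (+-comm (a * z) 1))))
unimodular⇒1≤x {x = suc _} _ = s≤s z≤n

unimodular⇒1≤b : ∀ {a b x z} → b * x ≡ a * z + 1 → 1 ≤ b
unimodular⇒1≤b {a} {zero} {x} {z} E = ⊥-elim (0≢1+n (trans E (+-comm (a * z) 1)))
unimodular⇒1≤b {b = suc _} _ = s≤s z≤n

unimodular⇒coprime : ∀ {a b x z} → b * x ≡ a * z + 1 → Coprime x z
unimodular⇒coprime {a} {b} E {d} (d∣x , d∣z) =
  ∣1⇒≡1 (∣m+n∣m⇒∣n (subst (d ∣_) E (∣-trans d∣x (n∣m*n b))) (∣-trans d∣z (n∣m*n a)))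

unimodular-shift : ∀ {a b x z} t → b * x ≡ a * z + 1 → b * (t * a + x) ≡ a * (t * b + z) + 1
unimodular-shift {a} {b} {x} {z} t E = begin
  b * (t * a + x)        ≡⟨ solve (b ∷ t ∷ a ∷ x ∷ []) ⟩
  t * a * b + b * x      ≡⟨ cong (t * a * b +_) E ⟩
  t * a * b + (a * z + 1) ≡⟨ solve (t ∷ a ∷ b ∷ z ∷ []) ⟩
  a * (t * b + z) + 1    ∎
  where open ≡-Reasoning

coprime⇒unimodular : ∀ {a b} .{{_ : NonZero b}} → Coprime a b → ∃₂ λ x z → b * x ≡ a * z + 1
coprime⇒unimodular {a} {b@(suc b′)} cop with coprime-Bézout (Coprime.sym cop)
... | Bézout.+- x y eq = x , y , (begin
  b * x      ≡⟨ *-comm b x ⟩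
  x * b      ≡⟨ eq ⟨
  1 + y * a  ≡⟨ solve (y ∷ a ∷ []) ⟩
  a * y + 1  ∎)
  where open ≡-Reasoning
... | Bézout.-+ x y eq = -- here a y − b x = 1, so b (b′ x + 1) − a (b′ y) = b − b′ = 1
  b′ * x + 1 , b′ * y , (begin
  b * (b′ * x + 1)        ≡⟨ solve (b′ ∷ x ∷ []) ⟩
  b′ * (1 + x * b) + 1    ≡⟨ cong (λ t → b′ * t + 1) eq ⟩
  b′ * (y * a) + 1        ≡⟨ solve (b′ ∷ y ∷ a ∷ []) ⟩
  a * (b′ * y) + 1        ∎)
  where open ≡-Reasoning

unimodular-unshift : ∀ {a b x z} t → b * x ≡ a * (t * b + z) + 1 → b * (x ∸ t * a) ≡ a * z + 1
unimodular-unshift {a} {b} {x} {z} t E = begin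
  b * (x ∸ t * a)                       ≡⟨ *-distribˡ-∸ b x (t * a) ⟩
  b * x ∸ b * (t * a)                   ≡⟨ cong (_∸ b * (t * a)) E ⟩
  a * (t * b + z) + 1 ∸ b * (t * a)     ≡⟨ cong (_∸ b * (t * a)) (solve (a ∷ t ∷ b ∷ z ∷ [])) ⟩
  a * z + 1 + b * (t * a) ∸ b * (t * a) ≡⟨ m+n∸n≡m (a * z + 1) (b * (t * a)) ⟩
  a * z + 1                             ∎
  where open ≡-Reasoning

unimodular⇒x≤a : ∀ {a b x z} .{{_ : NonZero b}} → 1 ≤ a → z < b → b * x ≡ a * z + 1 → x ≤ a
unimodular⇒x≤a {a} {b} {x} {z} 1≤a z<b E = *-cancelˡ-≤ b (begin
  b * x       ≡⟨ E ⟩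
  a * z + 1   ≤⟨ +-monoʳ-≤ (a * z) 1≤a ⟩
  a * z + a   ≡⟨ solve (a ∷ z ∷ []) ⟩
  a * suc z   ≤⟨ *-monoʳ-≤ a z<b ⟩
  a * b       ≡⟨ *-comm a b ⟩
  b * a       ∎)
  where open ≤-Reasoning

unimodular-reduce : ∀ {a b x z} .{{_ : NonZero b}} → 1 ≤ a → b * x ≡ a * z + 1 →
                    ∃₂ λ x′ z′ → b * x′ ≡ a * z′ + 1 × x′ ≤ a × z′ < b
unimodular-reduce {a} {b} {x} {z} 1≤a E =
  x ∸ z / b * a , z % b , E′ , unimodular⇒x≤a 1≤a (m%n<n z b) E′ , m%n<n z b
  where
  z≡ : z ≡ z / b * b + z % b
  z≡ = trans (m≡m%n+[m/n]*n z b) (+-comm (z % b) _)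
  E′ : b * (x ∸ z / b * a) ≡ a * (z % b) + 1
  E′ = unimodular-unshift {a} {b} {x} (z / b) (subst (λ z → b * x ≡ a * z + 1) z≡ E)

⟨<⟩⇔slope< : ∀ {h l h′ l′} → h ⟨ h + l < h′ ⟩ (h′ + l′) ⇔ h * l′ < l * h′
⟨<⟩⇔slope< {h} {l} {h′} {l′} = mk⇔
  (λ lt → +-cancelˡ-< (h * h′) _ _ (subst₂ _<_ lhs rhs lt))
  (λ lt → subst₂ _<_ (sym lhs) (sym rhs) (+-monoʳ-< (h * h′) lt))
  where
  lhs : h * (h′ + l′) ≡ h * h′ + h * l′
  lhs = *-distribˡ-+ h h′ l′
  rhs : h′ * (h + l) ≡ h * h′ + l * h′
  rhs = solve (h′ ∷ h ∷ l ∷ [])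

-- c = c (b x − a z) = (x d − z c) a + (b c − a d) x, with the subtractions moved across.
cramer : ∀ {a b x z c d D α} → b * x ≡ a * z + 1 → b * c ≡ a * d + D → x * d ≡ z * c + α →
         c ≡ α * a + D * x × d ≡ α * b + D * z
cramer {a} {b} {x} {z} {c} {d} {D} {α} E HD Hα = sym h-coordinate , sym l-coordinate
  where
  open ≡-Reasoning
  h-coordinate : α * a + D * x ≡ c
  h-coordinate = +-cancelʳ-≡ (a * z * c) _ _ (begin
    α * a + D * x + a * z * c  ≡⟨ solve (α ∷ a ∷ D ∷ x ∷ z ∷ c ∷ []) ⟩
    a * (z * c + α) + D * x    ≡⟨ cong (λ t → a * t + D * x) Hα ⟨
    a * (x * d) + D * x        ≡⟨ solve (a ∷ x ∷ d ∷ D ∷ []) ⟩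
    x * (a * d + D)            ≡⟨ cong (x *_) HD ⟨
    x * (b * c)                ≡⟨ solve (x ∷ b ∷ c ∷ []) ⟩
    c * (b * x)                ≡⟨ cong (c *_) E ⟩
    c * (a * z + 1)            ≡⟨ solve (c ∷ a ∷ z ∷ []) ⟩
    c + a * z * c              ∎)
  l-coordinate : α * b + D * z ≡ d
  l-coordinate = +-cancelʳ-≡ (b * z * c + a * d * z) _ _ (begin
    α * b + D * z + (b * z * c + a * d * z)  ≡⟨ solve (α ∷ b ∷ D ∷ z ∷ c ∷ a ∷ d ∷ []) ⟩
    b * (z * c + α) + z * (a * d + D)        ≡⟨ cong₂ (λ t u → b * t + z * u) Hα HD ⟨
    b * (x * d) + z * (b * c)                ≡⟨ solve (b ∷ x ∷ d ∷ z ∷ c ∷ []) ⟩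
    d * (b * x) + b * z * c                  ≡⟨ cong (λ t → d * t + b * z * c) E ⟩
    d * (a * z + 1) + b * z * c              ≡⟨ solve (d ∷ a ∷ z ∷ b ∷ c ∷ []) ⟩
    d + (b * z * c + a * d * z)              ∎)

Box : ℕ → ℕ → ℕ → ℕ → Set
Box n m h l = h ≤ m × l ≤ n ∸ m

Box? : ∀ n m h l → Dec (Box n m h l)
Box? n m h l = (h ≤? m) ×-dec (l ≤? n ∸ m)

Box⇒InF : ∀ {n m h l} → m ≤ n → 1 ≤ h → Coprime h l → Box n m h l → InF n m h (h + l)
Box⇒InF {n} {m} {h} {l} m≤n 1≤h cop (h≤m , l≤n∸m) =
  ≤-trans 1≤h (m≤m+n h l) ,
  ≤-trans (+-mono-≤ h≤m l≤n∸m) (≤-reflexive (m+[n∸m]≡n m≤n)) ,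
  m≤m+n h l ,
  Coprime.sym (coprime-+ (Coprime.sym cop)) ,
  inj₂ (inj₂ (h≤m , subst (_≤ n ∸ m) (sym (m+n∸m≡n h l)) l≤n∸m))

InF⇒Box : ∀ {n m h l} → 1 ≤ h → 1 ≤ l → InF n m h (h + l) → Box n m h l
InF⇒Box {l = zero} _ () _
InF⇒Box () _ (_ , _ , _ , _ , inj₁ (refl , _))
InF⇒Box {l = suc _} _ _ (_ , _ , _ , _ , inj₂ (inj₁ (refl , ())))
InF⇒Box {n} {m} {h} {l} _ _ (_ , _ , _ , _ , inj₂ (inj₂ (h≤m , k∸h≤n∸m))) =
  h≤m , subst (_≤ n ∸ m) (m+n∸m≡n h l) k∸h≤n∸m

record BoxNeighbour (n m a b : ℕ) : Set where
  constructor boxNeighbour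
  field
    {x z}      : ℕ
    unimodular : b * x ≡ a * z + 1
    member     : InF n m x (x + z)
    saturated  : ¬ Box n m (a + x) (b + z)

unimodular-Box⇒BoxNeighbour : ∀ {n m a b x₀ z₀} .{{_ : NonZero b}} → m ≤ n →
                              b * x₀ ≡ a * z₀ + 1 → Box n m x₀ z₀ → BoxNeighbour n m a b
unimodular-Box⇒BoxNeighbour {n} {m} {a} {b} {x₀} {z₀} m≤n E₀ w₀∈Box =
  neighbourAt
    (P0∧¬PN⇒∃[t]Pt∧¬P[1+t] (λ t → Box? n m (t * a + x₀) (t * b + z₀)) w₀∈Box (suc (n ∸ m)) escapes)
  where
  escapes : ¬ Box n m (suc (n ∸ m) * a + x₀) (suc (n ∸ m) * b + z₀)
  escapes (_ , too-big) = 1+n≰n (≤-trans (≤-trans (m≤m*n (suc (n ∸ m)) b) (m≤m+n _ z₀)) too-big)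
  neighbourAt : (∃ λ t → Box n m (t * a + x₀) (t * b + z₀) ×
                        ¬ Box n m (suc t * a + x₀) (suc t * b + z₀)) →
                BoxNeighbour n m a b
  neighbourAt (t , w∈Box , P+w∉Box) =
    boxNeighbour E
      (Box⇒InF m≤n (unimodular⇒1≤x {a} {b} E) (unimodular⇒coprime {a} {b} E) w∈Box)
      (P+w∉Box ∘ subst₂ (Box n m) (sym (+-assoc a (t * a) x₀)) (sym (+-assoc b (t * b) z₀)))
    where
    E : b * (t * a + x₀) ≡ a * (t * b + z₀) + 1
    E = unimodular-shift {a} {b} {x₀} {z₀} t E₀

Box⇒BoxNeighbour : ∀ {n m a b} .{{_ : NonZero a}} .{{_ : NonZero b}} →
                   m ≤ n → Coprime a b → Box n m a b → BoxNeighbour n m a b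
Box⇒BoxNeighbour {a = a} m≤n cop (a≤m , b≤n∸m)
  with _ , _ , E ← coprime⇒unimodular cop
  with _ , _ , E₀ , x₀≤a , z₀<b ← unimodular-reduce (>-nonZero⁻¹ a) E
  = unimodular-Box⇒BoxNeighbour m≤n E₀ (≤-trans x₀≤a a≤m , ≤-trans (<⇒≤ z₀<b) b≤n∸m)

InF⇒BoxNeighbour : ∀ {n m a b} → 1 ≤ n → m ≤ n → 1 ≤ b → InF n m a (a + b) →
                   BoxNeighbour n m a b
InF⇒BoxNeighbour {n} {zero} {zero} 1≤n _ _ (_ , _ , _ , cop , _)
  rewrite 0-coprimeTo-m⇒m≡1 cop =
  boxNeighbour {x = 1} {0} refl (s≤s z≤n , 1≤n , s≤s z≤n , 1-coprimeTo 1 , inj₂ (inj₁ (refl , refl)))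
    λ ()
InF⇒BoxNeighbour {n} {m@(suc _)} {zero} _ m≤n _ (_ , _ , _ , cop , _)
  rewrite 0-coprimeTo-m⇒m≡1 cop =
  boxNeighbour {x = 1} {n ∸ m} refl (Box⇒InF m≤n (s≤s z≤n) (1-coprimeTo _) (s≤s z≤n , ≤-refl))
    λ (_ , 1+r≤r) → 1+n≰n 1+r≤r
InF⇒BoxNeighbour {b = zero} _ _ () _
InF⇒BoxNeighbour {a = suc _} {suc _} _ m≤n _ P∈F@(_ , _ , _ , cop , _) =
  Box⇒BoxNeighbour m≤n (λ (d∣a , d∣b) → cop (d∣a , ∣m∣n⇒∣m+n d∣a d∣b))
                       (InF⇒Box (s≤s z≤n) (s≤s z≤n) P∈F)

InF-combination⇒D≡1 : ∀ {n m a b x z c d} α D′ → 1 ≤ x → 1 ≤ b →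
                      InF n m c (c + d) → ¬ Box n m (a + x) (b + z) →
                      c ≡ α * a + suc D′ * x → d ≡ α * b + suc D′ * z → suc D′ ≡ 1
InF-combination⇒D≡1 {x = x} {z} zero D′ _ _ (_ , _ , _ , cop , _) _ refl refl =
  cop (m∣m*n x , ∣m∣n⇒∣m+n (m∣m*n x) (m∣m*n z))
InF-combination⇒D≡1 {a = a} {b} {x} {z} (suc α′) D′ 1≤x 1≤b Q∈F P+w∉Box refl refl =
  ⊥-elim (P+w∉Box (Product.map (≤-trans a+x≤c) (≤-trans b+z≤d) (InF⇒Box 1≤c 1≤d Q∈F)))
  where
  a+x≤c : a + x ≤ suc α′ * a + suc D′ * x
  a+x≤c = +-mono-≤ (m≤n*m a (suc α′)) (m≤n*m x (suc D′))
  b+z≤d : b + z ≤ suc α′ * b + suc D′ * z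
  b+z≤d = +-mono-≤ (m≤n*m b (suc α′)) (m≤n*m z (suc D′))
  1≤c : 1 ≤ suc α′ * a + suc D′ * x
  1≤c = ≤-trans 1≤x (≤-trans (m≤n+m x a) a+x≤c)
  1≤d : 1 ≤ suc α′ * b + suc D′ * z
  1≤d = ≤-trans 1≤b (≤-trans (m≤m+n b z) b+z≤d)

BoxNeighbour⇒successor-unimodular : ∀ {n m a b c d} →
  Successive n m a (a + b) c (c + d) → BoxNeighbour n m a b → b * c ≡ a * d + 1
BoxNeighbour⇒successor-unimodular {a = a} {b} {c} {d}
  (_ , Q∈F , P<Q , nothing-between) (boxNeighbour {x} {z} E w∈F P+w∉Box)
  = let D′ , HD   = m≤n⇒∃[o]m+o≡n (Equivalence.to (⟨<⟩⇔slope< {a} {b} {c} {d}) P<Q)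
        α , Hα    = m≤n⇒∃[o]m+o≡n (≮⇒≥ w≮Q)
        bc≡ad+D   = trans (sym HD) (sym (+-suc (a * d) D′))
        c≡ , d≡   = cramer {a} {b} {x} {z} {c} {d} E bc≡ad+D (sym Hα)
    in trans bc≡ad+D (cong (a * d +_)
         (InF-combination⇒D≡1 α D′ (unimodular⇒1≤x {a} {b} E) (unimodular⇒1≤b {a} {b} E)
                              Q∈F P+w∉Box c≡ d≡))
  where
  P<w : a * z < b * x
  P<w = ≤-reflexive (sym (trans E (+-comm (a * z) 1)))
  w≮Q : ¬ (x * d < z * c)
  w≮Q w<Q = nothing-between x (x + z) w∈F
    (Equivalence.from (⟨<⟩⇔slope< {a} {b} {x} {z}) P<w)
    (Equivalence.from (⟨<⟩⇔slope< {x} {z} {c} {d}) w<Q)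

successive⇒unimodular : ∀ {n m a b c d} → 1 ≤ n → m ≤ n →
                        Successive n m a (a + b) c (c + d) → b * c ≡ a * d + 1
successive⇒unimodular {a = a} {zero} {c} {d} _ _ (_ , _ , P<Q , _) =
  ⊥-elim (n≮0 (Equivalence.to (⟨<⟩⇔slope< {a} {0} {c} {d}) P<Q))
successive⇒unimodular {b = suc _} 1≤n m≤n s@(P∈F , _) =
  BoxNeighbour⇒successor-unimodular s (InF⇒BoxNeighbour 1≤n m≤n (s≤s z≤n) P∈F)

successive⇒det≡1 : ∀ {n m h k h′ k′} → 1 ≤ n → m ≤ n →
                   Successive n m h k h′ k′ → k * h′ ≡ h * k′ + 1
successive⇒det≡1 {h = h} {h′ = h′} 1≤n m≤n s@((_ , _ , h≤k , _) , (_ , _ , h′≤k′ , _) , _)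
  with l , refl ← m≤n⇒∃[o]m+o≡n h≤k | l′ , refl ← m≤n⇒∃[o]m+o≡n h′≤k′ = begin
  (h + l) * h′          ≡⟨ solve (h ∷ l ∷ h′ ∷ []) ⟩
  h * h′ + l * h′       ≡⟨ cong (h * h′ +_) (successive⇒unimodular 1≤n m≤n s) ⟩
  h * h′ + (h * l′ + 1) ≡⟨ solve (h ∷ h′ ∷ l′ ∷ []) ⟩
  h * (h′ + l′) + 1     ∎
  where open ≡-Reasoning

unimodular-mediant : ∀ {h₁ k₁ h₂ k₂ h₃ k₃} → k₁ * h₂ ≡ h₁ * k₂ + 1 → k₂ * h₃ ≡ h₂ * k₃ + 1 →
                     (h₁ + h₃) * k₂ ≡ h₂ * (k₁ + k₃)
unimodular-mediant {h₁} {k₁} {h₂} {k₂} {h₃} {k₃} e₁₂ e₂₃ = +-cancelʳ-≡ 1 _ _ (begin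
  (h₁ + h₃) * k₂ + 1       ≡⟨ solve (h₁ ∷ h₃ ∷ k₂ ∷ []) ⟩
  (h₁ * k₂ + 1) + k₂ * h₃  ≡⟨ cong (_+ k₂ * h₃) e₁₂ ⟨
  k₁ * h₂ + k₂ * h₃        ≡⟨ cong (k₁ * h₂ +_) e₂₃ ⟩
  k₁ * h₂ + (h₂ * k₃ + 1)  ≡⟨ solve (k₁ ∷ h₂ ∷ k₃ ∷ []) ⟩
  h₂ * (k₁ + k₃) + 1       ∎)
  where open ≡-Reasoning

reduce-gcd : ∀ {p q g} → gcd p q ≡ suc g → reduce p q ≡ (p / suc g , q / suc g)
reduce-gcd {p} {q} e with gcd p q | e
... | _ | refl = refl

reduce-* : ∀ c {a b} .{{_ : NonZero c}} → Coprime a b → reduce (c * a) (c * b) ≡ (a , b)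
reduce-* c@(suc _) {a} {b} cop = begin
  reduce (c * a) (c * b)   ≡⟨ reduce-gcd gcd≡c ⟩
  (c * a / c , c * b / c)  ≡⟨ cong₂ _,_ (*/-cancel a) (*/-cancel b) ⟩
  (a , b)                  ∎
  where
  open ≡-Reasoning
  gcd≡c : gcd (c * a) (c * b) ≡ c
  gcd≡c = trans (sym (c*gcd[m,n]≡gcd[cm,cn] c a b))
                (trans (cong (c *_) (coprime⇒gcd≡1 cop)) (*-identityʳ c))
  */-cancel : ∀ y → c * y / c ≡ y
  */-cancel y = trans (cong (_/ c) (*-comm c y)) (m*n/n≡m y c)

coprime-proportional : ∀ {p q h k} .{{_ : NonZero q}} → Coprime h k → p * k ≡ h * q →
                       ∃ λ t → NonZero t × p ≡ t * h × q ≡ t * k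
coprime-proportional {p} {h = h} {k} cop pk≡hq
  with divides t refl ← coprime-divisor (Coprime.sym cop) (divides p (sym pk≡hq)) =
  t , m*n≢0⇒m≢0 t ,
  *-cancelʳ-≡ p (t * h) k {{m*n≢0⇒n≢0 t}} (trans pk≡hq (solve (h ∷ t ∷ k ∷ []))) ,
  refl

proportional⇒reduce≡ : ∀ {p q h k} .{{_ : NonZero q}} → Coprime h k → p * k ≡ h * q →
                       reduce p q ≡ (h , k)
proportional⇒reduce≡ {p} {q} {h} {k} cop pk≡hq
  with t , t≢0 , refl , refl ← coprime-proportional {p} {q} {h} {k} cop pk≡hq = reduce-* t {{t≢0}} cop

successive²⇒mediant : ∀ {n m h₁ k₁ h₂ k₂ h₃ k₃} → 1 ≤ n → m ≤ n →
                      Successive n m h₁ k₁ h₂ k₂ → Successive n m h₂ k₂ h₃ k₃ →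
                      (h₂ , k₂) ≡ reduce (h₁ + h₃) (k₁ + k₃)
successive²⇒mediant {h₁ = h₁} {k₁} {h₂} {k₂} 1≤n m≤n
  s₁₂@((1≤k₁ , _) , (_ , _ , _ , cop₂ , _) , _) s₂₃ =
  sym (proportional⇒reduce≡ {{>-nonZero (≤-trans 1≤k₁ (m≤m+n _ _))}} cop₂
    (unimodular-mediant {h₁} {k₁} {h₂} {k₂}
      (successive⇒det≡1 1≤n m≤n s₁₂) (successive⇒det≡1 1≤n m≤n s₂₃)))

proposition7p7 : (n m : ℕ) → 1 ≤ n →
    ((m ≤ n) → (h₁ k₁ h₂ k₂ : ℕ) → Successive n m h₁ k₁ h₂ k₂ →
       k₁ * h₂ ≡ h₁ * k₂ + 1)
    × ((0 < m) → (m < n) → (h₁ k₁ h₂ k₂ h₃ k₃ : ℕ) →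
       Successive n m h₁ k₁ h₂ k₂ → Successive n m h₂ k₂ h₃ k₃ →
       (h₂ , k₂) ≡ reduce (h₁ + h₃) (k₁ + k₃))
-- (ii) holds for every m ≤ n: the hypothesis 0 < m < n only excludes F(B(n),m;ρ) = {0/1, 1/1}.
proposition7p7 n m 1≤n =
  (λ m≤n _ _ _ _ → successive⇒det≡1 1≤n m≤n) ,
  (λ _ m<n _ _ _ _ _ _ → successive²⇒mediant 1≤n (<⇒≤ m<n))
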